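{- If $1\leq h<\omega$ and $2\leq w<\omega$, then $C_h(w)$ exists and $C_h(w)\leq(h!\,w)^{2h!}$.
   Context: Each $n<\omega$ is identified with $\{0,\dots,n-1\}$. For $1\leq h<\omega$, an $h$-structure $(X;\overline E)=(X;E_0,\dots,E_{h-1})$ consists of a nonempty finite set $X$ and equivalence relations $E_i$ on $X$ with $E_0=X\times X$ and $E_i\supseteq E_{i+1}$ for $i<h-1$; $E_h$ denotes the identity relation on $X$. For $\varnothing\neq Y\subseteq X$, $Y$ induces the $h$-substructure $(Y;E_0\cap Y^2,\dots,E_{h-1}\cap Y^2)$. The $h$-structure is $(I,w)$-special if $w\geq2$ and: (i) $I=\{i<h:E_i$ not discrete and $i=\max\{j<h:E_j=E_i\}\}$; (ii) every $E_i$-class ($i\in I$) contains at least $w$ $E_{i+1}$-classes. "$(h,w)$-special" means $(I,w)$-special with $I=\{0,\dots,h-1\}$. A function $f$ defined on $X$ is canonical on $(X;\overline E)$ if there is $i\leq h$ such that for all $x,y\in X$, $f(x)=f(y)$ iff $\langle x,y\rangle\in E_i$. For $2\leq w<\omega$, $C_h(w)$ is the least number $2\leq C<\omega$ (if one exists) such that whenever $(X;\overline E)$ is an $(h,C)$-special $h$-structure and $f:X\to\omega$, there is $Y\subseteq X$ inducing an $(h,w)$-special $h$-substructure on which $f$ is canonical. -}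

module Defs where

open import Data.Nat using (ℕ; zero; suc; _≤_; _*_; _^_; _!)
open import Data.Fin using (Fin; zero; suc; toℕ; fromℕ; inject₁)
open import Data.Bool using (Bool; T; true)
open import Data.Product using (Σ; ∃; _×_; _,_)
open import Relation.Binary.PropositionalEquality using (_≡_)
open import Relation.Binary.Structures using (IsEquivalence)
open import Relation.Nullary using (¬_)
open import Function.Bundles using (_⇔_)

-- The relations are indexed by Fin (suc h): indices 0,…,h-1 are E_0,…,E_{h-1},
-- and index h is E_h, required to be the identity relation.
-- Relations on a finite set are given as Bool-valued functions
-- (x E_i y  iff  T (E i x y)).
record HStructure (h n : ℕ) : Set where
  field
    E       : Fin (suc h) → Fin n → Fin n → Bool
    isEquiv : (i : Fin (suc h)) → IsEquivalence (λ x y → T (E i x y))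
    E-top   : ∀ x y → T (E zero x y)
    E-id    : ∀ x y → T (E (fromℕ h) x y) ⇔ (x ≡ y)
    E-mono  : (i : Fin h) → ∀ x y →
              T (E (suc i) x y) → T (E (inject₁ i) x y)

open HStructure public

Subset : ℕ → Set
Subset n = Fin n → Bool

_∈_ : ∀ {n} → Fin n → Subset n → Set
x ∈ Y = T (Y x)

NonEmpty : ∀ {n} → Subset n → Set
NonEmpty Y = ∃ λ x → x ∈ Y

module _ {h n : ℕ} (S : HStructure h n) (Y : Subset n) where

  R : Fin (suc h) → Fin n → Fin n → Set
  R i x y = T (E S i x y)

  SameOn : Fin (suc h) → Fin (suc h) → Set
  SameOn i j = ∀ x y → x ∈ Y → y ∈ Y → R i x y ⇔ R j x y

  NotDiscrete : Fin (suc h) → Set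
  NotDiscrete i = ∃ λ x → ∃ λ y → x ∈ Y × y ∈ Y × ¬ (x ≡ y) × R i x y

  IsMax : Fin h → Set
  IsMax i = (j : Fin h) → SameOn (inject₁ j) (inject₁ i) → toℕ j ≤ toℕ i

  ManyClasses : ℕ → Fin h → Set
  ManyClasses w i = ∀ x → x ∈ Y →
    Σ (Fin w → Fin n) λ g →
      (∀ k → g k ∈ Y × R (inject₁ i) x (g k)) ×
      (∀ k l → R (suc i) (g k) (g l) → k ≡ l)

  -- The substructure induced by Y is (h,w)-special, i.e. (I,w)-special with
  -- I = {0,…,h-1}: w ≥ 2, every i < h belongs to I (non-discrete and maximal
  -- among indices with the same relation), and condition (ii) for i ∈ I.
  HWSpecial : ℕ → Set
  HWSpecial w =
    NonEmpty Y × 2 ≤ w ×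
    ((i : Fin h) → NotDiscrete (inject₁ i) × IsMax i) ×
    ((i : Fin h) → ManyClasses w i)

  Canonical : (Fin n → ℕ) → Set
  Canonical f = ∃ λ (i : Fin (suc h)) →
    ∀ x y → x ∈ Y → y ∈ Y → (f x ≡ f y) ⇔ R i x y

Full : ∀ {n} → Subset n
Full _ = true

-- C satisfies the defining property of C_h(w)
-- (everything except minimality).
ArrowProp : (h w C : ℕ) → Set
ArrowProp h w C =
  ∀ (n : ℕ) (S : HStructure h n) → HWSpecial S Full C →
  ∀ (f : Fin n → ℕ) →
  ∃ λ (Y : Subset n) →
    HWSpecial S Y w × Canonical S Y f

bound : ℕ → ℕ → ℕ
bound h w = ((h !) * w) ^ (2 * (h !))

-- Inside a structure one embeds a copy of the complete w-ary tree of depth h: a leaf has an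
-- address p : Vec (Fin w) h, and two leaves are E_j-related exactly when their addresses agree
-- in the first j coordinates, so the image of the copy is (h, w)-special. The copy is grown
-- from the root: under each of the C children of a point one builds, recursively, wider
-- subtrees on which f is already canonical at some index i (f p = f q iff p and q agree in
-- their first i coordinates). By pigeonhole, w * w of these subtrees share the index i.
-- If i = 0 the subtrees are f-constant, and w of the w * w constants are equal (new index 0)
-- or w are distinct (new index 1). If i > 0, f separates the first-level branches of each
-- subtree, so each value of f is taken on at most one branch; pruning the subtrees one after
-- another to w branches that avoid all values already used makes their f-images pairwise
-- disjoint (new index i + 1). The widths this needs stay below (h! w)^(2 h!).
module Submission where

open import Defs

open import Data.Nat
  using (ℕ; zero; suc; _+_; _*_; _^_; _⊔_; _!; pred; _≤_; _<_; _≤′_; ≤′-refl; ≤′-step; z≤n; s≤s; _≟_; _≤?_; ≢-nonZero; >-nonZero)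
open import Data.Nat.Properties
  using (≤-refl; ≤-reflexive; ≤-trans; module ≤-Reasoning; ≤⇒≤′; ≰⇒>; 1+n≰n; n≤0⇒n≡0; m≤n⇒m≤1+n; pred-mono-≤; suc-pred;
         +-comm; +-suc; +-identityʳ; m≤m+n; m≤n+m; +-monoˡ-≤; +-monoʳ-≤; *-identityʳ; m≤m*n; m≤n*m; *-mono-≤; *-monoˡ-≤; *-monoʳ-≤;
         ^-*-assoc; ^-monoˡ-≤; ^-monoʳ-≤; ⊔-lub; m≤m⊔n; m≤n⊔m; 1≤n!)
open import Data.Nat.Solver using (module +-*-Solver)
open import Data.Fin using (Fin; zero; suc; toℕ; fromℕ<; inject₁; inject≤; combine)
open import Data.Fin.Properties
  using (suc-injective; toℕ-fromℕ<; inject≤-injective; combine-injective; injective⇒≤; any?) renaming (_≟_ to _≟ᶠ_)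
open import Data.Vec using (Vec; []; _∷_; map; replicate; _[_]≔_)
import Data.Vec.Functional as Vector
open import Data.Product using (Σ; ∃; _×_; _,_; proj₁; proj₂)
import Data.Product as Product
open import Data.Sum using (_⊎_; inj₁; inj₂)
import Data.Sum as Sum
open import Data.Bool using (T)
open import Data.Unit using (⊤; tt)
open import Function using (_∘_)
open import Function.Definitions using (Injective)
open import Function.Bundles using (_⇔_; mk⇔; Equivalence)
open import Function.Construct.Composition using (_⇔-∘_)
open import Function.Construct.Symmetry using (⇔-sym)
open import Relation.Nullary using (¬_; Dec; yes; no; contradiction)
open import Relation.Nullary.Decidable using (map′; isYes; toWitness; fromWitness)
open import Relation.Unary using (Decidable)
open import Relation.Binary.Structures using (IsEquivalence)
open import Relation.Binary.PropositionalEquality using (_≡_; _≢_; refl; sym; trans; cong; subst)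

record Selection (t : ℕ) {N : ℕ} (P : Fin N → Set) : Set where
  constructor selection
  field
    pick          : Fin t → Fin N
    pick-injective : Injective _≡_ _≡_ pick
    pick-∈        : ∀ k → P (pick k)

open Selection

module _ {N : ℕ} {P : Fin N → Set} where

  Selection-empty : Selection 0 P
  Selection-empty = selection (λ ()) (λ { {()} }) (λ ())

  Selection-map : ∀ {t} {Q : Fin N → Set} → (∀ {b} → P b → Q b) → Selection t P → Selection t Q
  Selection-map P⇒Q (selection ι ι-inj ι-P) = selection ι ι-inj (P⇒Q ∘ ι-P)

  Selection-∘ : ∀ {s t} (A : Selection s P) {Q : Fin N → Set} →
    Selection t (Q ∘ pick A) → Selection t (λ b → P b × Q b)
  Selection-∘ (selection ι ι-inj ι-P) (selection κ κ-inj κ-Q) =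
    selection (ι ∘ κ) (κ-inj ∘ ι-inj) (λ k → ι-P (κ k) , κ-Q k)

module _ {N : ℕ} {P : Fin (suc N) → Set} where

  Selection-suc : ∀ {t} → Selection t (P ∘ suc) → Selection t P
  Selection-suc (selection ι ι-inj ι-P) = selection (suc ∘ ι) (ι-inj ∘ suc-injective) ι-P

  Selection-zero∷ : ∀ {t} → P zero → Selection t (P ∘ suc) → Selection (suc t) P
  Selection-zero∷ P0 (selection ι ι-inj ι-P) =
    selection (zero Vector.∷ suc ∘ ι) injective (λ { zero → P0 ; (suc k) → ι-P k })
    where
    injective : Injective _≡_ _≡_ (zero Vector.∷ suc ∘ ι)
    injective {zero}  {zero}  _ = refl
    injective {suc k} {suc l} e = cong suc (ι-inj (suc-injective e))

Selection-split : ∀ {N} {P : Fin N → Set} t s → Decidable P → t + s ≤ suc N →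
  Selection t P ⊎ Selection s (¬_ ∘ P)
Selection-split zero    s       _  _ = inj₁ Selection-empty
Selection-split (suc t) zero    _  _ = inj₂ Selection-empty
Selection-split {zero} (suc t) (suc s) _ (s≤s t+1+s≤0) = contradiction (≤-trans (m≤n+m (suc s) t) t+1+s≤0) λ ()
Selection-split {suc N} (suc t) (suc s) P? (s≤s t+s≤N) with P? zero
... | yes P0 = Sum.map (Selection-zero∷ P0) Selection-suc (Selection-split t (suc s) (P? ∘ suc) t+s≤N)
... | no ¬P0 = Sum.map Selection-suc (Selection-zero∷ ¬P0)
  (Selection-split (suc t) s (P? ∘ suc) (subst (_≤ suc N) (+-suc t s) t+s≤N))

fewBad⇒manyGood : ∀ {N u} w {P : Fin N → Set} → Decidable P →
  (β : ∀ {b} → P b → Fin u) → (∀ {b b′} (x : P b) (y : P b′) → β x ≡ β y → b ≡ b′) →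
  w + u ≤ N → Selection w (¬_ ∘ P)
fewBad⇒manyGood {N} {u} w P? β β-injective w+u≤N
  with Selection-split (suc u) w P? (s≤s (subst (_≤ N) (+-comm w u) w+u≤N))
... | inj₂ good = good
... | inj₁ bad = contradiction (injective⇒≤ β∘bad-injective) 1+n≰n
  where
  β∘bad-injective : Injective _≡_ _≡_ (β ∘ pick-∈ bad)
  β∘bad-injective e = pick-injective bad (β-injective _ _ e)

pigeonhole-≤ : ∀ {N} r t (c : Fin N → ℕ) → (∀ k → c k ≤ r) → suc r * t ≤ N →
  ∃ λ i → i ≤ r × Selection t (λ k → c k ≡ i)
pigeonhole-≤ zero t c c≤0 t+0≤N =
  0 , z≤n , selection (λ k → inject≤ k t≤N) (inject≤-injective _ _ _ _) (λ k → n≤0⇒n≡0 (c≤0 _))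
  where
  t≤N = ≤-trans (m≤m+n t 0) t+0≤N
pigeonhole-≤ {N} (suc r) t c c≤r le
  with Selection-split t (suc r * t) (λ k → c k ≟ 0) (m≤n⇒m≤1+n le)
... | inj₁ zeros = 0 , z≤n , zeros
... | inj₂ nonzeros
  with i , i≤r , same ← pigeonhole-≤ r t (pred ∘ c ∘ pick nonzeros) (λ k → pred-mono-≤ (c≤r _)) ≤-refl
  = suc i , s≤s i≤r , Selection-map c≡suc-i (Selection-∘ nonzeros same)
  where
  c≡suc-i : ∀ {b} → c b ≢ 0 × pred (c b) ≡ i → c b ≡ suc i
  c≡suc-i {b} (c≢0 , pred≡i) = trans (sym (suc-pred (c b) {{≢-nonZero c≢0}})) (cong suc pred≡i)

equalOrDistinct : ∀ {N} s t (v : Fin N → ℕ) → s * t ≤ N →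
  (∃ λ c → Selection t (λ k → v k ≡ c)) ⊎ (Σ (Fin s → Fin N) λ ι → Injective _≡_ _≡_ (v ∘ ι))
equalOrDistinct s zero v _ = inj₁ (0 , Selection-empty)
equalOrDistinct zero (suc t) v _ = inj₂ ((λ ()) , λ { {()} })
equalOrDistinct {zero} (suc s) (suc t) v ()
equalOrDistinct {suc N} (suc s) (suc t) v (s≤s le)
  with Selection-split t (s * suc t) (λ k → v (suc k) ≟ v zero) (m≤n⇒m≤1+n le)
... | inj₁ same = inj₁ (v zero , Selection-zero∷ refl same)
... | inj₂ other with equalOrDistinct s (suc t) (v ∘ suc ∘ pick other) ≤-refl
...   | inj₁ (c , same) = inj₁ (c , Selection-suc (Selection-map proj₂ (Selection-∘ other same)))
...   | inj₂ (ι , distinct) = inj₂ (zero Vector.∷ suc ∘ pick other ∘ ι , injective)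
  where
  injective : Injective _≡_ _≡_ (v ∘ (zero Vector.∷ suc ∘ pick other ∘ ι))
  injective {zero}  {zero}  _ = refl
  injective {zero}  {suc l} e = contradiction (sym e) (pick-∈ other (ι l))
  injective {suc k} {zero}  e = contradiction e (pick-∈ other (ι k))
  injective {suc k} {suc l} e = cong suc (distinct e)

module _ {A : Set} where

  Agree : ∀ {d} → ℕ → Vec A d → Vec A d → Set
  Agree zero    _       _       = ⊤
  Agree (suc j) []      []      = ⊤
  Agree (suc j) (a ∷ p) (b ∷ q) = a ≡ b × Agree j p q

  Agree-refl : ∀ {d} j (p : Vec A d) → Agree j p p
  Agree-refl zero    _       = tt
  Agree-refl (suc j) []      = tt
  Agree-refl (suc j) (a ∷ p) = refl , Agree-refl j p

  Agree-[]≔ : ∀ {d} (p : Vec A d) i a → Agree (toℕ i) p (p [ i ]≔ a)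
  Agree-[]≔ (b ∷ p) zero    a = tt
  Agree-[]≔ (b ∷ p) (suc i) a = refl , Agree-[]≔ p i a

  Agree-suc-[]≔ : ∀ {d} (p : Vec A d) i {a b} → Agree (suc (toℕ i)) (p [ i ]≔ a) (p [ i ]≔ b) → a ≡ b
  Agree-suc-[]≔ (c ∷ p) zero    (a≡b , _) = a≡b
  Agree-suc-[]≔ (c ∷ p) (suc i) (_ , ag)  = Agree-suc-[]≔ p i ag

PreservesAgree : ∀ {A B : Set} {d} → (Vec B d → Vec A d) → Set
PreservesAgree ρ = ∀ j {p q} → Agree j (ρ p) (ρ q) ⇔ Agree j p q

CanonicalAt : ∀ {A V : Set} {d} → ℕ → (Vec A d → V) → Set
CanonicalAt i g = ∀ p q → g p ≡ g q ⇔ Agree i p q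

CanonicalAt-∘ : ∀ {A B V : Set} {d i} {g : Vec A d → V} {ρ : Vec B d → Vec A d} →
  CanonicalAt i g → PreservesAgree ρ → CanonicalAt i (g ∘ ρ)
CanonicalAt-∘ {i = i} {ρ = ρ} canonical preserves p q = preserves i ⇔-∘ canonical (ρ p) (ρ q)

module _ {A : Set} where

  graft : ∀ {B : Set} {d} → (A → Vec A d → B) → Vec A (suc d) → B
  graft Ψ (a ∷ p) = Ψ a p

  module _ {B V : Set} (f : B → V) {d} {Ψ : A → Vec A d → B} where

    graft-constant : (∀ {a b p q} → f (Ψ a p) ≡ f (Ψ b q)) → CanonicalAt 0 (f ∘ graft Ψ)
    graft-constant constant (a ∷ p) (b ∷ q) = mk⇔ (λ _ → tt) (λ _ → constant)

    graft-canonicalAt-suc : ∀ {i} → (∀ a → CanonicalAt i (f ∘ Ψ a)) →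
      (∀ {a b p q} → f (Ψ a p) ≡ f (Ψ b q) → a ≡ b) → CanonicalAt (suc i) (f ∘ graft Ψ)
    graft-canonicalAt-suc canonical disjoint (a ∷ p) (b ∷ q) = mk⇔ to from
      where
      to : f (Ψ a p) ≡ f (Ψ b q) → a ≡ b × Agree _ p q
      to e with refl ← disjoint e = refl , Equivalence.to (canonical a p q) e
      from : a ≡ b × Agree _ p q → f (Ψ a p) ≡ f (Ψ b q)
      from (refl , ag) = Equivalence.from (canonical a p q) ag

module _ {A B : Set} {τ : A → B} (τ-injective : Injective _≡_ _≡_ τ) where

  map-preservesAgree : ∀ {d} → PreservesAgree (map {n = d} τ)
  map-preservesAgree j = mk⇔ (reflect j) (preserve j)
    where
    reflect : ∀ {d} j {p q : Vec A d} → Agree j (map τ p) (map τ q) → Agree j p q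
    reflect zero    {_}     {_}     _          = tt
    reflect (suc j) {[]}    {[]}    _          = tt
    reflect (suc j) {a ∷ p} {b ∷ q} (e , ag)   = τ-injective e , reflect j ag
    preserve : ∀ {d} j {p q : Vec A d} → Agree j p q → Agree j (map τ p) (map τ q)
    preserve zero    {_}     {_}     _          = tt
    preserve (suc j) {[]}    {[]}    _          = tt
    preserve (suc j) {a ∷ p} {b ∷ q} (e , ag)   = cong τ e , preserve j ag

mapHeadTail : ∀ {A B : Set} {d} → (A → B) → (A → B) → Vec A (suc d) → Vec B (suc d)
mapHeadTail σ τ (a ∷ p) = σ a ∷ map τ p

mapHeadTail-preservesAgree : ∀ {A B : Set} {d} {σ τ : A → B} →
  Injective _≡_ _≡_ σ → Injective _≡_ _≡_ τ →
  PreservesAgree (mapHeadTail {d = d} σ τ)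
mapHeadTail-preservesAgree σ-injective τ-injective zero    {a ∷ p} {b ∷ q} = mk⇔ (λ _ → tt) (λ _ → tt)
mapHeadTail-preservesAgree σ-injective τ-injective (suc j) {a ∷ p} {b ∷ q} =
  mk⇔ (Product.map σ-injective (Equivalence.to (map-preservesAgree τ-injective j)))
      (Product.map (cong _) (Equivalence.from (map-preservesAgree τ-injective j)))

any?-Vec : ∀ {k} d {P : Vec (Fin k) d → Set} → Decidable P → Dec (∃ P)
any?-Vec zero    P? = map′ ([] ,_) (λ { ([] , x) → x }) (P? [])
any?-Vec (suc d) P? = map′ (λ (a , p , x) → a ∷ p , x) (λ { (a ∷ p , x) → a , p , x })
  (any? λ a → any?-Vec d (P? ∘ (a ∷_)))

encode : ∀ {w e} → Vec (Fin w) e → Fin (w ^ e)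
encode []      = zero
encode (a ∷ p) = combine a (encode p)

encode-injective : ∀ {w e} → Injective _≡_ _≡_ (encode {w} {e})
encode-injective {x = []}    {[]}    _ = refl
encode-injective {x = a ∷ p} {b ∷ q} e
  with refl , e′ ← combine-injective a (encode p) b (encode q) e = cong (a ∷_) (encode-injective e′)

SeparatesFirst : ∀ {A V : Set} {d} → (Vec A (suc d) → V) → Set
SeparatesFirst F = ∀ {a b p q} → F (a ∷ p) ≡ F (b ∷ q) → a ≡ b

-- F separates first coordinates, so each value of G is hit from at most one first coordinate:
-- at most t * w ^ suc d of the m first coordinates must be avoided.
avoidingRow : ∀ {m w d t} (F : Vec (Fin m) (suc d) → ℕ) (G : Fin t → Vec (Fin w) (suc d) → ℕ) →
  SeparatesFirst F → w + t * w ^ suc d ≤ m →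
  Selection w (λ a → ∀ p s q → F (a ∷ p) ≢ G s q)
avoidingRow {m} {w} {d} {t} F G separates w+tW≤m =
  Selection-map (λ ¬hits p s q e → ¬hits (s , p , q , e))
    (fewBad⇒manyGood w hits? witness witness-injective w+tW≤m)
  where
  Hits : Fin m → Set
  Hits a = ∃ λ s → ∃ λ p → ∃ λ q → F (a ∷ p) ≡ G s q
  hits? : Decidable Hits
  hits? a = any? λ s → any?-Vec d λ p → any?-Vec (suc d) λ q → F (a ∷ p) ≟ G s q
  witness : ∀ {a} → Hits a → Fin (t * w ^ suc d)
  witness (s , _ , q , _) = combine s (encode q)
  witness-injective : ∀ {a b} (x : Hits a) (y : Hits b) → witness x ≡ witness y → a ≡ b
  witness-injective (s , p , q , e) (s′ , p′ , q′ , e′) eq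
    with refl , eq′ ← combine-injective s (encode q) s′ (encode q′) eq
    with refl ← encode-injective {x = q} {q′} eq′ = separates (trans e (sym e′))

record DisjointRows {m w d} (τ : Fin w → Fin m) (t : ℕ) (F : Fin t → Vec (Fin m) (suc d) → ℕ) : Set where
  field
    row           : Fin t → Fin w → Fin m
    row-injective : ∀ s → Injective _≡_ _≡_ (row s)
    disjoint      : ∀ {s s′ p q} →
                    F s (mapHeadTail (row s) τ p) ≡ F s′ (mapHeadTail (row s′) τ q) → s ≡ s′

open DisjointRows

disjointRows : ∀ {m w d} (τ : Fin w → Fin m) t (F : Fin t → Vec (Fin m) (suc d) → ℕ) →
  (∀ s → SeparatesFirst (F s)) → w + t * w ^ suc d ≤ m → DisjointRows τ t F
disjointRows τ zero F _ _ = record { row = λ () ; row-injective = λ () ; disjoint = λ { {()} } }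
disjointRows {m} {w} {d} τ (suc t) F separates w+W+tW≤m = record
  { row = pick first Vector.∷ row rest
  ; row-injective = λ { zero → pick-injective first ; (suc s) → row-injective rest s }
  ; disjoint = disjoint′
  }
  where
  w+tW≤m = ≤-trans (+-monoʳ-≤ w (m≤n+m (t * w ^ suc d) (w ^ suc d))) w+W+tW≤m
  rest = disjointRows τ t (F ∘ suc) (separates ∘ suc) w+tW≤m
  first = avoidingRow (F zero) (λ s → F (suc s) ∘ mapHeadTail (row rest s) τ) (separates zero) w+tW≤m
  disjoint′ : ∀ {s s′ p q} → F s (mapHeadTail ((pick first Vector.∷ row rest) s) τ p) ≡
    F s′ (mapHeadTail ((pick first Vector.∷ row rest) s′) τ q) → s ≡ s′
  disjoint′ {zero}  {zero}             _ = refl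
  disjoint′ {zero}  {suc s′} {a ∷ p} {q} e = contradiction e (pick-∈ first a (map τ p) s′ q)
  disjoint′ {suc s} {zero}  {p} {a ∷ q} e = contradiction (sym e) (pick-∈ first a (map τ q) s p)
  disjoint′ {suc s} {suc s′}           e = cong suc (disjoint rest e)

-- A fan of this width at the root of a depth-(suc d) tree of width w leaves room to apply
-- the pigeonhole principle to the suc d possible canonical indices of w * w subtrees, each
-- of which is built with width w + w ^ suc d.
requiredWidth : ℕ → ℕ → ℕ
requiredWidth zero    w = 0
requiredWidth (suc d) w = suc d * (w * w) ⊔ requiredWidth d (w + w ^ suc d)

module _ where
  open ≤-Reasoning
  open +-*-Solver

  *-^-≤ : ∀ {x} w → 1 ≤ x → ∀ k → x * w ^ suc k ≤ (x * w) ^ suc k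
  *-^-≤ {x} w 1≤x zero = ≤-reflexive (solve 2 (λ x w → x :* (w :* con 1) := (x :* w) :* con 1) refl x w)
  *-^-≤ {x} w 1≤x (suc k) = begin
    x * (w * w ^ suc k)       ≡⟨ solve 3 (λ x w p → x :* (w :* p) := w :* (x :* p)) refl x w (w ^ suc k) ⟩
    w * (x * w ^ suc k)       ≤⟨ *-monoʳ-≤ w (*-^-≤ w 1≤x k) ⟩
    w * (x * w) ^ suc k       ≤⟨ *-monoˡ-≤ ((x * w) ^ suc k) (m≤n*m w x {{>-nonZero 1≤x}}) ⟩
    (x * w) * (x * w) ^ suc k ∎

  module _ (d : ℕ) {w : ℕ} (1≤w : 1 ≤ w) where
    private
      X = suc d !
      1≤X = 1≤n! (suc d)
      1≤Xw = *-mono-≤ 1≤X 1≤w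

    w≤bound : w ≤ bound (suc d) w
    w≤bound = begin
      w               ≤⟨ m≤n*m w X {{>-nonZero 1≤X}} ⟩
      X * w           ≡⟨ sym (*-identityʳ (X * w)) ⟩
      (X * w) ^ 1     ≤⟨ ^-monoʳ-≤ (X * w) {{>-nonZero 1≤Xw}} (≤-trans 1≤X (m≤m+n X _)) ⟩
      bound (suc d) w ∎

    square≤bound : suc d * (w * w) ≤ bound (suc d) w
    square≤bound = begin
      suc d * (w * w)   ≤⟨ *-monoˡ-≤ (w * w) (m≤m*n (suc d) (d !) {{>-nonZero (1≤n! d)}}) ⟩
      X * (w * w)       ≤⟨ *-monoˡ-≤ (w * w) (m≤m*n X X {{>-nonZero 1≤X}}) ⟩
      (X * X) * (w * w) ≡⟨ solve 2 (λ X w → (X :* X) :* (w :* w) := (X :* w) :* ((X :* w) :* con 1)) refl X w ⟩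
      (X * w) ^ 2       ≤⟨ ^-monoʳ-≤ (X * w) {{>-nonZero 1≤Xw}} (*-monoʳ-≤ 2 1≤X) ⟩
      bound (suc d) w   ∎

    bound-step : 1 ≤ d → bound d (w + w ^ suc d) ≤ bound (suc d) w
    bound-step 1≤d = begin
      (F * (w + P)) ^ (2 * F)        ≤⟨ ^-monoˡ-≤ (2 * F) F[w+P]≤XP ⟩
      (X * P) ^ (2 * F)              ≤⟨ ^-monoˡ-≤ (2 * F) (*-^-≤ w 1≤X d) ⟩
      ((X * w) ^ suc d) ^ (2 * F)    ≡⟨ ^-*-assoc (X * w) (suc d) (2 * F) ⟩
      (X * w) ^ (suc d * (2 * F))    ≡⟨ cong ((X * w) ^_) (solve 2 (λ d F →
                                          (con 1 :+ d) :* (con 2 :* F) := con 2 :* ((con 1 :+ d) :* F)) refl d F) ⟩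
      bound (suc d) w                ∎
      where
      F = d !
      P = w ^ suc d
      F[w+P]≤XP : F * (w + P) ≤ X * P
      F[w+P]≤XP = begin
        F * (w + P)     ≤⟨ *-monoʳ-≤ F (+-monoˡ-≤ P w≤P) ⟩
        F * (P + P)     ≡⟨ solve 2 (λ F P → F :* (P :+ P) := (con 2 :* F) :* P) refl F P ⟩
        (2 * F) * P     ≤⟨ *-monoˡ-≤ P (*-monoˡ-≤ F (s≤s 1≤d)) ⟩
        X * P           ∎
        where
        w≤P : w ≤ P
        w≤P = subst (_≤ P) (*-identityʳ w) (^-monoʳ-≤ w {{>-nonZero 1≤w}} {1} {suc d} (s≤s z≤n))

requiredWidth≤bound : ∀ d {w} → 1 ≤ w → requiredWidth (suc d) w ≤ bound (suc d) w
requiredWidth≤bound zero    1≤w = ⊔-lub (square≤bound 0 1≤w) z≤n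
requiredWidth≤bound (suc d) 1≤w = ⊔-lub (square≤bound (suc d) 1≤w)
  (≤-trans (requiredWidth≤bound d (≤-trans 1≤w (m≤m+n _ _))) (bound-step (suc d) 1≤w (s≤s z≤n)))

-- Levels are indexed by ℕ; every level from h on denotes the identity relation E_h.
level : (h : ℕ) → ℕ → Fin (suc h)
level zero    _       = zero
level (suc h) zero    = zero
level (suc h) (suc j) = suc (level h j)

level-zero : ∀ h → level h 0 ≡ zero
level-zero zero    = refl
level-zero (suc h) = refl

level-toℕ : ∀ {h} (i : Fin h) → level h (toℕ i) ≡ inject₁ i
level-toℕ zero    = refl
level-toℕ (suc i) = cong suc (level-toℕ i)

level-suc-toℕ : ∀ {h} (i : Fin h) → level h (suc (toℕ i)) ≡ suc i
level-suc-toℕ {suc h} zero    = cong suc (level-zero h)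
level-suc-toℕ         (suc i) = cong suc (level-suc-toℕ i)

level-suc : ∀ h j →
  (∃ λ (i : Fin h) → level h j ≡ inject₁ i × level h (suc j) ≡ suc i) ⊎ level h (suc j) ≡ level h j
level-suc zero    j       = inj₂ refl
level-suc (suc h) zero    = inj₁ (zero , refl , cong suc (level-zero h))
level-suc (suc h) (suc j) = Sum.map (λ (i , e , e′) → suc i , cong suc e , cong suc e′) (cong suc) (level-suc h j)

module _ {h n : ℕ} (S : HStructure h n) where

  infix 4 _∼⟨_⟩_
  _∼⟨_⟩_ : Fin n → ℕ → Fin n → Set
  x ∼⟨ j ⟩ y = T (E S (level h j) x y)

  module _ (j : ℕ) where
    open IsEquivalence (isEquiv S (level h j)) public
      renaming (refl to ∼-refl; sym to ∼-sym; trans to ∼-trans)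

  E-cast : ∀ {l l′} → l ≡ l′ → ∀ {x y} → T (E S l x y) → T (E S l′ x y)
  E-cast refl r = r

  ∼-cast : ∀ {i j} → i ≡ j → ∀ {x y} → x ∼⟨ i ⟩ y → x ∼⟨ j ⟩ y
  ∼-cast e = E-cast (cong (level h) e)

  ∼-suc⇒ : ∀ j {x y} → x ∼⟨ suc j ⟩ y → x ∼⟨ j ⟩ y
  ∼-suc⇒ j {x} {y} r with level-suc h j
  ... | inj₁ (i , e , e′) = E-cast (sym e) (E-mono S i x y (E-cast e′ r))
  ... | inj₂ e            = E-cast e r

  ∼-mono : ∀ {i j} → i ≤ j → ∀ {x y} → x ∼⟨ j ⟩ y → x ∼⟨ i ⟩ y
  ∼-mono i≤j = go (≤⇒≤′ i≤j)
    where
    go : ∀ {i j} → i ≤′ j → ∀ {x y} → x ∼⟨ j ⟩ y → x ∼⟨ i ⟩ y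
    go ≤′-refl          r = r
    go (≤′-step i≤′j) r = go i≤′j (∼-suc⇒ _ r)

  record Fan (w a : ℕ) (x : Fin n) : Set where
    field
      child           : Fin w → Fin n
      child-below     : ∀ k → x ∼⟨ a ⟩ child k
      child-separated : ∀ {k l} → child k ∼⟨ suc a ⟩ child l → k ≡ l

  open Fan

  Fan-restrict : ∀ {w w′ a x} (F : Fan w a x) {ι : Fin w′ → Fin w} → Injective _≡_ _≡_ ι → Fan w′ a x
  Fan-restrict F {ι} ι-injective = record
    { child           = child F ∘ ι
    ; child-below     = child-below F ∘ ι
    ; child-separated = ι-injective ∘ child-separated F
    }

  record IsTree (a : ℕ) (x : Fin n) {w d} (φ : Vec (Fin w) d → Fin n) : Set where
    field
      below  : ∀ p → x ∼⟨ a ⟩ φ p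
      levels : ∀ j {p q} → φ p ∼⟨ a + j ⟩ φ q ⇔ Agree j p q

  open IsTree

  IsTree-point : ∀ {a x w} → IsTree a x {w} {0} (λ _ → x)
  IsTree-point {a} {x} = record
    { below  = λ _ → ∼-refl a
    ; levels = λ { j {[]} {[]} → mk⇔ (λ _ → Agree-refl j []) (λ _ → ∼-refl (a + j)) }
    }

  IsTree-∘ : ∀ {a x w m d} {φ : Vec (Fin m) d → Fin n} {ρ : Vec (Fin w) d → Vec (Fin m) d} →
    IsTree a x φ → PreservesAgree ρ → IsTree a x (φ ∘ ρ)
  IsTree-∘ {ρ = ρ} tree preserves = record
    { below  = below tree ∘ ρ
    ; levels = λ j → preserves j ⇔-∘ levels tree j
    }

  graft-isTree : ∀ {w d a x} (F : Fan w a x) {Ψ : Fin w → Vec (Fin w) d → Fin n} →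
    (∀ k → IsTree (suc a) (child F k) (Ψ k)) → IsTree a x (graft Ψ)
  graft-isTree {a = a} {x} F {Ψ} trees = record { below = below′ ; levels = levels′ }
    where
    below′ : ∀ p → x ∼⟨ a ⟩ graft Ψ p
    below′ (k ∷ p) = ∼-trans a (child-below F k) (∼-suc⇒ a (below (trees k) p))

    levels′ : ∀ j {p q} → graft Ψ p ∼⟨ a + j ⟩ graft Ψ q ⇔ Agree j p q
    levels′ zero {p} {q} =
      mk⇔ (λ _ → tt) (λ _ → ∼-cast (sym (+-identityʳ a)) (∼-trans a (∼-sym a (below′ p)) (below′ q)))
    levels′ (suc j) {k ∷ p} {l ∷ q} = mk⇔ (to ∘ ∼-cast (+-suc a j)) (∼-cast (sym (+-suc a j)) ∘ from)
      where
      children-related : Ψ k p ∼⟨ suc a + j ⟩ Ψ l q → child F k ∼⟨ suc a ⟩ child F l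
      children-related r = ∼-trans (suc a) (below (trees k) p)
        (∼-trans (suc a) (∼-mono (m≤m+n (suc a) j) r) (∼-sym (suc a) (below (trees l) q)))
      to : Ψ k p ∼⟨ suc a + j ⟩ Ψ l q → k ≡ l × Agree j p q
      to r with refl ← child-separated F (children-related r) = refl , Equivalence.to (levels (trees k) j) r
      from : k ≡ l × Agree j p q → Ψ k p ∼⟨ suc a + j ⟩ Ψ l q
      from (refl , ag) = Equivalence.from (levels (trees k) j) ag

  module _ (f : Fin n → ℕ) where

    record CanonicalTree (w d a : ℕ) (x : Fin n) : Set where
      field
        embedding : Vec (Fin w) d → Fin n
        isTree    : IsTree a x embedding
        index     : ℕ
        index≤    : index ≤ d
        canonical : CanonicalAt index (f ∘ embedding)

    open CanonicalTree

    module _ {w a x} (F : Fan (w * w) a x) (1≤w : 1 ≤ w) where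

      private
        pruned : ∀ {d m} {Ψ : Fin (w * w) → Vec (Fin m) d → Fin n} →
          (∀ k → IsTree (suc a) (child F k) (Ψ k)) →
          {κ : Fin w → Fin (w * w)} → Injective _≡_ _≡_ κ →
          {ρ : Fin w → Vec (Fin w) d → Vec (Fin m) d} → (∀ k → PreservesAgree (ρ k)) →
          IsTree a x (graft (λ k → Ψ (κ k) ∘ ρ k))
        pruned trees κ-injective preserves =
          graft-isTree (Fan-restrict F κ-injective) (λ k → IsTree-∘ (trees _) (preserves k))

      constantChildren : ∀ {d m} {Ψ : Fin (w * w) → Vec (Fin m) d → Fin n} → w ≤ m →
        (∀ k → IsTree (suc a) (child F k) (Ψ k)) → (∀ k → CanonicalAt 0 (f ∘ Ψ k)) →
        CanonicalTree w (suc d) a x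
      constantChildren {d} {m} {Ψ} w≤m trees constant = byValues (equalOrDistinct w w value ≤-refl)
        where
        τ : Fin w → Fin m
        τ k = inject≤ k w≤m
        τ-injective : Injective _≡_ _≡_ τ
        τ-injective = inject≤-injective _ _ _ _
        value : Fin (w * w) → ℕ
        value k = f (Ψ k (replicate d (τ (fromℕ< 1≤w))))
        value≡ : ∀ k p → f (Ψ k p) ≡ value k
        value≡ k p = Equivalence.from (constant k p _) tt
        byValues : (∃ λ c → Selection w (λ k → value k ≡ c)) ⊎
                   (Σ (Fin w → Fin (w * w)) λ κ → Injective _≡_ _≡_ (value ∘ κ)) →
                   CanonicalTree w (suc d) a x
        byValues (inj₁ (c , same)) = record
          { embedding = graft (λ k → Ψ (pick same k) ∘ map τ)
          ; isTree    = pruned trees (pick-injective same) (λ _ → map-preservesAgree τ-injective)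
          ; index     = 0
          ; index≤    = z≤n
          ; canonical = graft-constant f (trans (≡c _ _) (sym (≡c _ _)))
          }
          where
          ≡c : ∀ k p → f (Ψ (pick same k) p) ≡ c
          ≡c k p = trans (value≡ _ p) (pick-∈ same k)
        byValues (inj₂ (κ , distinct)) = record
          { embedding = graft (λ k → Ψ (κ k) ∘ map τ)
          ; isTree    = pruned trees (distinct ∘ cong value) (λ _ → map-preservesAgree τ-injective)
          ; index     = 1
          ; index≤    = s≤s z≤n
          ; canonical = graft-canonicalAt-suc f {i = 0}
              (λ k → CanonicalAt-∘ {i = 0} (constant (κ k)) (map-preservesAgree τ-injective))
              (λ e → distinct (trans (sym (value≡ _ _)) (trans e (value≡ _ _))))
          }

      separatedChildren : ∀ {d i} {Ψ : Fin (w * w) → Vec (Fin (w + w ^ suc (suc d))) (suc d) → Fin n} →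
        (∀ k → IsTree (suc a) (child F k) (Ψ k)) → i ≤ d → (∀ k → CanonicalAt (suc i) (f ∘ Ψ k)) →
        CanonicalTree w (suc (suc d)) a x
      separatedChildren {d} {i} {Ψ} trees i≤d canonical = record
        { embedding = graft (λ k → Ψ (κ k) ∘ mapHeadTail (row rows k) τ)
        ; isTree    = pruned trees κ-injective preserves
        ; index     = suc (suc i)
        ; index≤    = s≤s (s≤s i≤d)
        ; canonical =
            graft-canonicalAt-suc f (λ k → CanonicalAt-∘ (canonical (κ k)) (preserves k)) (disjoint rows)
        }
        where
        κ : Fin w → Fin (w * w)
        κ k = inject≤ k (m≤m*n w w {{>-nonZero 1≤w}})
        κ-injective : Injective _≡_ _≡_ κ
        κ-injective = inject≤-injective _ _ _ _
        τ : Fin w → Fin (w + w ^ suc (suc d))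
        τ k = inject≤ k (m≤m+n w _)
        τ-injective : Injective _≡_ _≡_ τ
        τ-injective = inject≤-injective _ _ _ _
        separates : ∀ k → SeparatesFirst (f ∘ Ψ (κ k))
        separates k e = proj₁ (Equivalence.to (canonical (κ k) (_ ∷ _) (_ ∷ _)) e)
        rows = disjointRows τ w (λ k → f ∘ Ψ (κ k)) separates ≤-refl
        preserves : ∀ k → PreservesAgree (mapHeadTail (row rows k) τ)
        preserves k = mapHeadTail-preservesAgree (row-injective rows k) τ-injective

      graftChildren : ∀ {d i} {Ψ : Fin (w * w) → Vec (Fin (w + w ^ suc d)) d → Fin n} →
        (∀ k → IsTree (suc a) (child F k) (Ψ k)) → i ≤ d → (∀ k → CanonicalAt i (f ∘ Ψ k)) →
        CanonicalTree w (suc d) a x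
      graftChildren {i = zero}            trees _         canonical = constantChildren (m≤m+n _ _) trees canonical
      graftChildren {suc d} {i = suc i} trees (s≤s i≤d) canonical = separatedChildren trees i≤d canonical

    module _ {C : ℕ} (fan : ∀ a x → a < h → Fan C a x) where

      canonicalTree : ∀ d a {w} → a + d ≤ h → 1 ≤ w → requiredWidth d w ≤ C → ∀ x → CanonicalTree w d a x
      canonicalTree zero a _ _ _ x = record
        { embedding = λ _ → x
        ; isTree    = IsTree-point
        ; index     = 0
        ; index≤    = z≤n
        ; canonical = λ { [] [] → mk⇔ (λ _ → tt) (λ _ → refl) }
        }
      canonicalTree (suc d) a {w} a+1+d≤h 1≤w enough x =
        graftSameIndex
          (pigeonhole-≤ d (w * w) (index ∘ subtree) (index≤ ∘ subtree) (≤-trans (m≤m⊔n _ _) enough))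
        where
        1+a+d≤h : suc a + d ≤ h
        1+a+d≤h = subst (_≤ h) (+-suc a d) a+1+d≤h
        F : Fan C a x
        F = fan a x (≤-trans (m≤m+n (suc a) d) 1+a+d≤h)
        subtree : ∀ k → CanonicalTree (w + w ^ suc d) d (suc a) (child F k)
        subtree k =
          canonicalTree d (suc a) 1+a+d≤h (≤-trans 1≤w (m≤m+n _ _)) (≤-trans (m≤n⊔m _ _) enough) (child F k)
        graftSameIndex : (∃ λ i → i ≤ d × Selection (w * w) (λ k → index (subtree k) ≡ i)) →
                         CanonicalTree w (suc d) a x
        graftSameIndex (i , i≤d , same) =
          graftChildren (Fan-restrict F (pick-injective same)) 1≤w (isTree ∘ subtree ∘ pick same) i≤d
            (λ k → subst (λ i → CanonicalAt i (f ∘ embedding (subtree (pick same k)))) (pick-∈ same k)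
                     (canonical (subtree (pick same k))))

  manyClasses⇒Fan : ∀ {C} → ((i : Fin h) → ManyClasses S Full C i) → ∀ a x → a < h → Fan C a x
  manyClasses⇒Fan {C} many a x a<h = subst (λ a → Fan C a x) (toℕ-fromℕ< a<h) (fanAt (fromℕ< a<h))
    where
    fanAt : (i : Fin h) → Fan C (toℕ i) x
    fanAt i with g , inside , separated ← many i x tt = record
      { child           = g
      ; child-below     = λ k → E-cast (sym (level-toℕ i)) (proj₂ (inside k))
      ; child-separated = λ r → separated _ _ (E-cast (level-suc-toℕ i) r)
      }

  manyClasses⇒notDiscrete×isMax : ∀ {Y : Subset n} {w x} {i : Fin h} → x ∈ Y → 2 ≤ w →
    ManyClasses S Y w i → NotDiscrete S Y (inject₁ i) × IsMax S Y i
  manyClasses⇒notDiscrete×isMax {Y} {suc (suc w)} {x} {i} x∈Y (s≤s (s≤s _)) many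
    with g , inside , separated ← many x x∈Y = notDiscrete , isMax
    where
    g₀∼g₁ : T (E S (inject₁ i) (g zero) (g (suc zero)))
    g₀∼g₁ = IsEquivalence.trans (isEquiv S (inject₁ i))
      (IsEquivalence.sym (isEquiv S (inject₁ i)) (proj₂ (inside zero))) (proj₂ (inside (suc zero)))
    g₀≁g₁ : ¬ T (E S (suc i) (g zero) (g (suc zero)))
    g₀≁g₁ r with () ← separated _ _ r
    notDiscrete : NotDiscrete S Y (inject₁ i)
    notDiscrete = g zero , g (suc zero) , proj₁ (inside zero) , proj₁ (inside (suc zero)) ,
      (λ e → g₀≁g₁ (subst (λ z → T (E S (suc i) (g zero) z)) e (IsEquivalence.refl (isEquiv S (suc i))))) ,
      g₀∼g₁
    isMax : IsMax S Y i
    isMax j same with toℕ j ≤? toℕ i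
    ... | yes j≤i = j≤i
    ... | no  j≰i = contradiction (E-cast (level-suc-toℕ i) (∼-mono (≰⇒> j≰i) (E-cast (sym (level-toℕ j))
      (Equivalence.from (same _ _ (proj₁ (inside zero)) (proj₁ (inside (suc zero)))) g₀∼g₁)))) g₀≁g₁

  module _ {w x} {φ : Vec (Fin w) h → Fin n} (tree : IsTree 0 x φ) where

    image : Subset n
    image y = isYes (any?-Vec h (λ p → φ p ≟ᶠ y))

    φ∈image : ∀ p → φ p ∈ image
    φ∈image p = fromWitness (p , refl)

    ∈image : ∀ {y} → y ∈ image → ∃ λ p → φ p ≡ y
    ∈image = toWitness

    image-manyClasses : ∀ i → ManyClasses S image w i
    image-manyClasses i y y∈image with p , refl ← ∈image y∈image =
      (λ k → φ (p [ i ]≔ k)) ,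
      (λ k → φ∈image _ , E-cast (level-toℕ i) (Equivalence.from (levels tree (toℕ i)) (Agree-[]≔ p i k))) ,
      (λ k l r → Agree-suc-[]≔ p i (Equivalence.to (levels tree (suc (toℕ i))) (E-cast (sym (level-suc-toℕ i)) r)))

    image-hwSpecial : 2 ≤ w → HWSpecial S image w
    image-hwSpecial 2≤w =
      (φ p₀ , φ∈image p₀) , 2≤w ,
      (λ i → manyClasses⇒notDiscrete×isMax (φ∈image p₀) 2≤w (image-manyClasses i)) , image-manyClasses
      where
      p₀ = replicate h (fromℕ< (≤-trans (s≤s z≤n) 2≤w))

    image-canonical : ∀ (f : Fin n → ℕ) {j} → CanonicalAt j (f ∘ φ) → Canonical S image f
    image-canonical f {j} canonical = level h j , canonical′
      where
      canonical′ : ∀ y z → y ∈ image → z ∈ image → (f y ≡ f z) ⇔ T (E S (level h j) y z)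
      canonical′ y z y∈image z∈image with p , refl ← ∈image y∈image | q , refl ← ∈image z∈image =
        ⇔-sym (levels tree j) ⇔-∘ canonical p q

corollary3p7 : (h w : ℕ) → 1 ≤ h → 2 ≤ w →
    ∃ λ (C : ℕ) → 2 ≤ C × C ≤ bound h w × ArrowProp h w C
corollary3p7 (suc h) w _ 2≤w = bound (suc h) w , ≤-trans 2≤w (w≤bound h 1≤w) , ≤-refl , arrow
  where
  1≤w = ≤-trans (s≤s z≤n) 2≤w
  arrow : ArrowProp (suc h) w (bound (suc h) w)
  arrow n S ((x , _) , _ , _ , many) f =
    image S tree , image-hwSpecial S tree 2≤w , image-canonical S tree f (CanonicalTree.canonical tree₀)
    where
    tree₀ = canonicalTree S f (manyClasses⇒Fan S many) (suc h) 0 ≤-refl 1≤w (requiredWidth≤bound h 1≤w) x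
    tree = CanonicalTree.isTree tree₀
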